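{- Suppose that for every integer $r\ge 2$ and every $r$-uniform hypergraph $H$ with $|V(H)|\le r\chi(H)+r-1$ one has $\chi_l(H)=\chi(H)$. Then for every graph $G$ and every integer $d\ge 0$ with $|V(G)|\le (d+2)\chi^d(G)+(d+1)$, one has $\chi^d_l(G)=\chi^d(G)$.
   Context: Graphs and hypergraphs are finite. A coloring of a hypergraph is proper if no edge is monochromatic; $\chi$ and $\chi_l$ denote chromatic number and list chromatic number (least $k$ such that for every assignment of lists of exactly $k$ colors to the vertices there is a proper coloring choosing each vertex's color from its list). A coloring of a graph $G$ is $d$-improper if each color class induces a subgraph of maximum degree at most $d$; $\chi^d(G)$ is the least number of colors in a $d$-improper coloring, and $\chi^d_l(G)$ is the least $k$ such that for every assignment of lists of exactly $k$ colors there is a $d$-improper coloring choosing each vertex's color from its list. -}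

module Defs where

open import Data.Nat using (ℕ; _<_; _≤_; _≡ᵇ_)
open import Data.Bool using (Bool; true; false; _∧_)
open import Data.Fin using (Fin)
open import Data.Fin.Subset using (Subset; ∣_∣) renaming (_∈_ to _∈ₛ_)
open import Data.Vec using (tabulate)
open import Data.List using (List; length)
open import Data.List.Relation.Unary.All using (All)
open import Data.List.Relation.Unary.Unique.Propositional using (Unique)
open import Data.List.Membership.Propositional using (_∈_)
open import Data.Product using (Σ; ∃; _×_)
open import Relation.Nullary using (¬_)
open import Relation.Binary.PropositionalEquality using (_≡_)

Colouring : ℕ → Set
Colouring n = Fin n → ℕ

record Hypergraph (n : ℕ) : Set where
  field
    edges : List (Subset n)
open Hypergraph public

Uniform : ∀ {n} → ℕ → Hypergraph n → Set
Uniform r H = All (λ e → ∣ e ∣ ≡ r) (edges H)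

Monochromatic : ∀ {n} → Colouring n → Subset n → Set
Monochromatic c e = ∀ u v → u ∈ₛ e → v ∈ₛ e → c u ≡ c v

ProperH : ∀ {n} → Hypergraph n → Colouring n → Set
ProperH H c = All (λ e → ¬ Monochromatic c e) (edges H)

ColourableH : ∀ {n} → Hypergraph n → ℕ → Set
ColourableH {n} H k = Σ (Colouring n) λ c → (∀ v → c v < k) × ProperH H c

IsChromaticNumber : ∀ {n} → Hypergraph n → ℕ → Set
IsChromaticNumber H k = ColourableH H k × (∀ j → j < k → ¬ ColourableH H j)

ListColourableH : ∀ {n} → Hypergraph n → ℕ → Set
ListColourableH {n} H k =
  (L : Fin n → List ℕ) → (∀ v → length (L v) ≡ k) → (∀ v → Unique (L v)) →
  Σ (Colouring n) λ c → (∀ v → c v ∈ L v) × ProperH H c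

IsListChromaticNumber : ∀ {n} → Hypergraph n → ℕ → Set
IsListChromaticNumber H k = ListColourableH H k × (∀ j → j < k → ¬ ListColourableH H j)

record Graph (n : ℕ) : Set where
  field
    Adj    : Fin n → Fin n → Bool
    sym    : ∀ u v → Adj u v ≡ Adj v u
    irrefl : ∀ v → Adj v v ≡ false
open Graph public

sameColourNbrs : ∀ {n} → Graph n → Colouring n → Fin n → Subset n
sameColourNbrs G c v = tabulate (λ u → Adj G v u ∧ (c u ≡ᵇ c v))

Improper : ∀ {n} → ℕ → Graph n → Colouring n → Set
Improper d G c = ∀ v → ∣ sameColourNbrs G c v ∣ ≤ d

ImproperColourable : ∀ {n} → ℕ → Graph n → ℕ → Set
ImproperColourable {n} d G k = Σ (Colouring n) λ c → (∀ v → c v < k) × Improper d G c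

IsImproperChromaticNumber : ∀ {n} → ℕ → Graph n → ℕ → Set
IsImproperChromaticNumber d G k =
  ImproperColourable d G k × (∀ j → j < k → ¬ ImproperColourable d G j)

ImproperListColourable : ∀ {n} → ℕ → Graph n → ℕ → Set
ImproperListColourable {n} d G k =
  (L : Fin n → List ℕ) → (∀ v → length (L v) ≡ k) → (∀ v → Unique (L v)) →
  Σ (Colouring n) λ c → (∀ v → c v ∈ L v) × Improper d G c

IsImproperListChromaticNumber : ∀ {n} → ℕ → Graph n → ℕ → Set
IsImproperListChromaticNumber d G k =
  ImproperListColourable d G k × (∀ j → j < k → ¬ ImproperListColourable d G j)

-- A colouring of G is d-improper exactly when it is a proper colouring of the
-- (d+2)-uniform "star hypergraph" of G, whose edges are the (d+2)-sets made of a
-- vertex together with d+1 of its neighbours: a monochromatic star exhibits d+1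
-- same-coloured neighbours, and conversely d+1 same-coloured neighbours of v form,
-- with v, a monochromatic star. Hence χ^d(G) is the chromatic number of this
-- hypergraph, and with r = d+2 the vertex bound is r χ + r - 1, so the hypothesis
-- makes every list assignment of size χ^d(G) d-improperly colourable. Conversely a
-- d-improper colouring from the lists {0,…,j-1} is a d-improper j-colouring, so
-- χ^d_l(G) ≥ χ^d(G).
module Submission where

open import Defs
open import Data.Nat using (ℕ; zero; suc; _+_; _*_; _∸_; _≤_; z≤n; s≤s; _≟_; _≤?_)
open import Data.Nat.Properties
  using (≤-trans; +-comm; +-suc; +-monoʳ-≤; +-∸-assoc; m≤n+m; n≮n; ≰⇒>; ≡ᵇ⇒≡; ≡⇒≡ᵇ; module ≤-Reasoning)
open import Data.Bool using (Bool; T)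
open import Data.Bool.Properties using (T-≡; T-∧)
open import Data.Fin using (Fin) renaming (zero to fzero; suc to fsuc)
open import Data.Fin.Properties using (any?)
open import Data.Fin.Subset using (Subset; ∣_∣; inside; outside; ⊥; ⁅_⁆; _∪_; _⊆_; _∉_) renaming (_∈_ to _∈ₛ_)
open import Data.Fin.Subset.Properties
  using (_∈?_; _⊆?_; p⊆q⇒∣p∣≤∣q∣; ∣p∣≤∣x∷p∣; ∣⊥∣≡0; ∉⊥; ∣⁅x⁆∣≡1; x∈⁅x⁆; x∈⁅y⁆⇒x≡y; x∈p∪q⁺; x∈p∪q⁻; ∪-identityˡ)
open import Data.Vec using ([]; _∷_; tabulate; here; there)
open import Data.Vec.Properties using ([]=⇒lookup; lookup⇒[]=; lookup∘tabulate)
open import Data.List using (List; filter; map; _++_; upTo) renaming ([] to []ₗ; _∷_ to _∷ₗ_)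
open import Data.List.Properties using (length-upTo)
open import Data.List.Relation.Unary.All as All using ()
open import Data.List.Relation.Unary.Any using () renaming (here to hereₗ)
open import Data.List.Relation.Unary.Unique.Propositional.Properties using (upTo⁺)
open import Data.List.Membership.Propositional using (_∈_)
open import Data.List.Membership.Propositional.Properties using (∈-filter⁺; ∈-filter⁻; ∈-upTo⁻; ∈-map⁺; ∈-++⁺ˡ; ∈-++⁺ʳ)
open import Data.Product using (∃; _×_; _,_; proj₁; proj₂)
open import Data.Sum as Sum using (inj₁; inj₂)
open import Function using (_∘_)
open import Function.Bundles using (_⇔_; mk⇔; Equivalence)
open import Relation.Nullary using (Dec; yes; no; contradiction)
open import Relation.Nullary.Decidable using (_×-dec_)
open import Relation.Binary.PropositionalEquality using (_≡_; refl; trans; cong; subst) renaming (sym to ≡-sym)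

open Equivalence using (to; from)

∣p∪q∣≤∣p∣+∣q∣ : ∀ {n} (p q : Subset n) → ∣ p ∪ q ∣ ≤ ∣ p ∣ + ∣ q ∣
∣p∪q∣≤∣p∣+∣q∣ []            []            = z≤n
∣p∪q∣≤∣p∣+∣q∣ (inside ∷ p)  (y ∷ q)       = s≤s (≤-trans (∣p∪q∣≤∣p∣+∣q∣ p q) (+-monoʳ-≤ ∣ p ∣ (∣p∣≤∣x∷p∣ y q)))
∣p∪q∣≤∣p∣+∣q∣ (outside ∷ p) (inside ∷ q)  = subst (suc ∣ p ∪ q ∣ ≤_) (≡-sym (+-suc ∣ p ∣ ∣ q ∣)) (s≤s (∣p∪q∣≤∣p∣+∣q∣ p q))
∣p∪q∣≤∣p∣+∣q∣ (outside ∷ p) (outside ∷ q) = ∣p∪q∣≤∣p∣+∣q∣ p q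

x∉p⇒∣⁅x⁆∪p∣≡1+∣p∣ : ∀ {n} {x : Fin n} {p : Subset n} → x ∉ p → ∣ ⁅ x ⁆ ∪ p ∣ ≡ suc ∣ p ∣
x∉p⇒∣⁅x⁆∪p∣≡1+∣p∣ {x = fzero}  {inside ∷ p}  x∉p = contradiction here x∉p
x∉p⇒∣⁅x⁆∪p∣≡1+∣p∣ {x = fzero}  {outside ∷ p} _   = cong (λ q → suc ∣ q ∣) (∪-identityˡ p)
x∉p⇒∣⁅x⁆∪p∣≡1+∣p∣ {x = fsuc x} {inside ∷ p}  x∉p = cong suc (x∉p⇒∣⁅x⁆∪p∣≡1+∣p∣ (λ x∈p → x∉p (there x∈p)))
x∉p⇒∣⁅x⁆∪p∣≡1+∣p∣ {x = fsuc x} {outside ∷ p} x∉p = x∉p⇒∣⁅x⁆∪p∣≡1+∣p∣ (λ x∈p → x∉p (there x∈p))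

p⊆⁅x⁆∪q⇒∣p∣≤1+∣q∣ : ∀ {n} {x : Fin n} {p q : Subset n} → p ⊆ ⁅ x ⁆ ∪ q → ∣ p ∣ ≤ suc ∣ q ∣
p⊆⁅x⁆∪q⇒∣p∣≤1+∣q∣ {x = x} {p} {q} p⊆ = begin
  ∣ p ∣             ≤⟨ p⊆q⇒∣p∣≤∣q∣ p⊆ ⟩
  ∣ ⁅ x ⁆ ∪ q ∣     ≤⟨ ∣p∪q∣≤∣p∣+∣q∣ ⁅ x ⁆ q ⟩
  ∣ ⁅ x ⁆ ∣ + ∣ q ∣ ≡⟨ cong (_+ ∣ q ∣) (∣⁅x⁆∣≡1 x) ⟩
  suc ∣ q ∣         ∎
  where open ≤-Reasoning

∪-monoʳ-⊆ : ∀ {n} (p : Subset n) {q q′ : Subset n} → q ⊆ q′ → p ∪ q ⊆ p ∪ q′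
∪-monoʳ-⊆ p {q} q⊆q′ x∈ = x∈p∪q⁺ (Sum.map₂ q⊆q′ (x∈p∪q⁻ p q x∈))

∃-⊆-of-size : ∀ {n} (p : Subset n) {m} → m ≤ ∣ p ∣ → ∃ λ q → q ⊆ p × ∣ q ∣ ≡ m
∃-⊆-of-size {n} p {zero} _ = ⊥ , (λ x∈⊥ → contradiction x∈⊥ ∉⊥) , ∣⊥∣≡0 n
∃-⊆-of-size (outside ∷ p) {suc m} 1+m≤∣p∣ with ∃-⊆-of-size p 1+m≤∣p∣
... | q , q⊆p , ∣q∣≡1+m = outside ∷ q , (λ { (there x∈q) → there (q⊆p x∈q) }) , ∣q∣≡1+m
∃-⊆-of-size (inside ∷ p) {suc m} (s≤s m≤∣p∣) with ∃-⊆-of-size p m≤∣p∣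
... | q , q⊆p , ∣q∣≡m = inside ∷ q , (λ { here → here ; (there x∈q) → there (q⊆p x∈q) }) , cong suc ∣q∣≡m

∈-tabulate⇔ : ∀ {n} {f : Fin n → Bool} {x : Fin n} → x ∈ₛ tabulate f ⇔ T (f x)
∈-tabulate⇔ {f = f} {x} = mk⇔
  (λ x∈ → from T-≡ (trans (≡-sym (lookup∘tabulate f x)) ([]=⇒lookup x∈)))
  (λ fx → lookup⇒[]= x _ (trans (lookup∘tabulate f x) (to T-≡ fx)))

allSubsets : ∀ n → List (Subset n)
allSubsets zero    = [] ∷ₗ []ₗ
allSubsets (suc n) = map (inside ∷_) (allSubsets n) ++ map (outside ∷_) (allSubsets n)

∈-allSubsets : ∀ {n} (p : Subset n) → p ∈ allSubsets n
∈-allSubsets []                    = hereₗ refl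
∈-allSubsets {suc n} (inside ∷ p)  = ∈-++⁺ˡ (∈-map⁺ (inside ∷_) (∈-allSubsets p))
∈-allSubsets {suc n} (outside ∷ p) = ∈-++⁺ʳ (map (inside ∷_) (allSubsets n)) (∈-map⁺ (outside ∷_) (∈-allSubsets p))

module _ {n : ℕ} (G : Graph n) where

  neighbours : Fin n → Subset n
  neighbours v = tabulate (Adj G v)

  ∈-sameColourNbrs⇔ : ∀ {c : Colouring n} {v u} →
    u ∈ₛ sameColourNbrs G c v ⇔ (u ∈ₛ neighbours v × c u ≡ c v)
  ∈-sameColourNbrs⇔ {c} {v} {u} = mk⇔
    (λ u∈ → let adj , same = to T-∧ (to ∈-tabulate⇔ u∈) in from ∈-tabulate⇔ adj , ≡ᵇ⇒≡ (c u) (c v) same)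
    (λ (u∈N , cu≡cv) → from ∈-tabulate⇔ (from T-∧ (to ∈-tabulate⇔ u∈N , ≡⇒≡ᵇ (c u) (c v) cu≡cv)))

  v∉neighbours : ∀ v → v ∉ neighbours v
  v∉neighbours v v∈N = subst T (irrefl G v) (to ∈-tabulate⇔ v∈N)

  IsStar : Subset n → Set
  IsStar e = ∃ λ v → v ∈ₛ e × e ⊆ ⁅ v ⁆ ∪ neighbours v

  isStar? : ∀ e → Dec (IsStar e)
  isStar? e = any? λ v → (v ∈? e) ×-dec (e ⊆? ⁅ v ⁆ ∪ neighbours v)

  module _ (r : ℕ) where

    IsStarEdge : Subset n → Set
    IsStarEdge e = ∣ e ∣ ≡ r × IsStar e

    isStarEdge? : ∀ e → Dec (IsStarEdge e)
    isStarEdge? e = (∣ e ∣ ≟ r) ×-dec isStar? e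

    stars : Hypergraph n
    stars = record { edges = filter isStarEdge? (allSubsets n) }

    ∈-stars⁺ : ∀ {e} → IsStarEdge e → e ∈ edges stars
    ∈-stars⁺ {e} = ∈-filter⁺ isStarEdge? (∈-allSubsets e)

    ∈-stars⁻ : ∀ {e} → e ∈ edges stars → IsStarEdge e
    ∈-stars⁻ e∈ = proj₂ (∈-filter⁻ isStarEdge? {xs = allSubsets n} e∈)

    stars-uniform : Uniform r stars
    stars-uniform = All.tabulate (λ e∈ → proj₁ (∈-stars⁻ e∈))

  module _ {c : Colouring n} {v : Fin n} where

    monochromatic-star⊆ : ∀ {e} → Monochromatic c e → v ∈ₛ e → e ⊆ ⁅ v ⁆ ∪ neighbours v →
      e ⊆ ⁅ v ⁆ ∪ sameColourNbrs G c v
    monochromatic-star⊆ {e} mono v∈e e⊆ {u} u∈e with x∈p∪q⁻ ⁅ v ⁆ (neighbours v) (e⊆ u∈e)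
    ... | inj₁ u∈⁅v⁆ = x∈p∪q⁺ (inj₁ u∈⁅v⁆)
    ... | inj₂ u∈N   = x∈p∪q⁺ (inj₂ (from ∈-sameColourNbrs⇔ (u∈N , mono u v u∈e v∈e)))

    centre∪sameColour-monochromatic : ∀ {q} → q ⊆ sameColourNbrs G c v → Monochromatic c (⁅ v ⁆ ∪ q)
    centre∪sameColour-monochromatic {q} q⊆ u w u∈ w∈ = trans (colour≡ u∈) (≡-sym (colour≡ w∈))
      where
        colour≡ : ∀ {u} → u ∈ₛ ⁅ v ⁆ ∪ q → c u ≡ c v
        colour≡ u∈ with x∈p∪q⁻ ⁅ v ⁆ q u∈
        ... | inj₁ u∈⁅v⁆ = cong c (x∈⁅y⁆⇒x≡y v u∈⁅v⁆)
        ... | inj₂ u∈q   = proj₂ (to ∈-sameColourNbrs⇔ (q⊆ u∈q))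

    sameColourNbrs⊆neighbours : sameColourNbrs G c v ⊆ neighbours v
    sameColourNbrs⊆neighbours u∈ = proj₁ (to (∈-sameColourNbrs⇔ {c}) u∈)

    v∉sameColourNbrs : v ∉ sameColourNbrs G c v
    v∉sameColourNbrs v∈ = v∉neighbours v (sameColourNbrs⊆neighbours v∈)

module _ {n : ℕ} (G : Graph n) (d : ℕ) {c : Colouring n} where

  improper⇒proper : Improper d G c → ProperH (stars G (d + 2)) c
  improper⇒proper improper = All.tabulate λ {e} e∈ mono →
    let ∣e∣≡d+2 , v , v∈e , e⊆ = ∈-stars⁻ G (d + 2) e∈ in
    n≮n (suc d) (begin
      2 + d                             ≡⟨ +-comm 2 d ⟩
      d + 2                             ≡⟨ ≡-sym ∣e∣≡d+2 ⟩
      ∣ e ∣                             ≤⟨ p⊆⁅x⁆∪q⇒∣p∣≤1+∣q∣ (monochromatic-star⊆ G mono v∈e e⊆) ⟩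
      suc ∣ sameColourNbrs G c v ∣      ≤⟨ s≤s (improper v) ⟩
      suc d                             ∎)
    where open ≤-Reasoning

  proper⇒improper : ProperH (stars G (d + 2)) c → Improper d G c
  proper⇒improper proper v with ∣ sameColourNbrs G c v ∣ ≤? d
  ... | yes ∣N∣≤d = ∣N∣≤d
  ... | no  ∣N∣≰d with ∃-⊆-of-size (sameColourNbrs G c v) (≰⇒> ∣N∣≰d)
  ...   | q , q⊆N , ∣q∣≡1+d =
    contradiction (centre∪sameColour-monochromatic G q⊆N) (All.lookup proper (∈-stars⁺ G (d + 2) isStarEdge))
    where
      isStarEdge : IsStarEdge G (d + 2) (⁅ v ⁆ ∪ q)
      isStarEdge =
          trans (x∉p⇒∣⁅x⁆∪p∣≡1+∣p∣ (v∉sameColourNbrs G {c} ∘ q⊆N)) (trans (cong suc ∣q∣≡1+d) (+-comm 2 d))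
        , v , x∈p∪q⁺ (inj₁ (x∈⁅x⁆ v)) , ∪-monoʳ-⊆ ⁅ v ⁆ (sameColourNbrs⊆neighbours G {c} ∘ q⊆N)

stars-proper⇔improper : ∀ {n} (G : Graph n) d c → ProperH (stars G (d + 2)) c ⇔ Improper d G c
stars-proper⇔improper G d c = mk⇔ (proper⇒improper G d {c}) (improper⇒proper G d)

module _ {n : ℕ} (d : ℕ) (G : Graph n) (H : Hypergraph n)
         (proper⇔improper : ∀ c → ProperH H c ⇔ Improper d G c) where

  improperChromatic⇒chromatic : ∀ {k} → IsImproperChromaticNumber d G k → IsChromaticNumber H k
  improperChromatic⇒chromatic ((c , c<k , improper) , minimal) =
      (c , c<k , from (proper⇔improper c) improper)
    , λ j j<k (c′ , c′<j , proper) → minimal j j<k (c′ , c′<j , to (proper⇔improper c′) proper)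

  listColourable⇒improperListColourable : ∀ {k} → ListColourableH H k → ImproperListColourable d G k
  listColourable⇒improperListColourable colourable L ∣L∣≡k unique =
    let c , c∈L , proper = colourable L ∣L∣≡k unique in c , c∈L , to (proper⇔improper c) proper

improperListColourable⇒improperColourable : ∀ {n d j} {G : Graph n} →
  ImproperListColourable d G j → ImproperColourable d G j
improperListColourable⇒improperColourable colourable =
  let c , c∈upTo , improper = colourable (λ _ → upTo _) (λ _ → length-upTo _) (λ _ → upTo⁺ _) in
  c , (λ v → ∈-upTo⁻ (c∈upTo v)) , improper

theorem2p3 : (∀ (r : ℕ) → 2 ≤ r → ∀ (n : ℕ) (H : Hypergraph n) → Uniform r H →
      ∀ (k : ℕ) → IsChromaticNumber H k → n ≤ r * k + (r ∸ 1) →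
      IsListChromaticNumber H k) →
    ∀ (n : ℕ) (G : Graph n) (d k : ℕ) → IsImproperChromaticNumber d G k →
      n ≤ (d + 2) * k + (d + 1) →
      IsImproperListChromaticNumber d G k
theorem2p3 hypothesis n G d k χᵈ bound =
    listColourable⇒improperListColourable d G H (stars-proper⇔improper G d) (proj₁ χₗ)
  , λ j j<k → proj₂ χᵈ j j<k ∘ improperListColourable⇒improperColourable {G = G}
  where
    H : Hypergraph n
    H = stars G (d + 2)

    bound′ : n ≤ (d + 2) * k + (d + 2 ∸ 1)
    bound′ = subst (λ m → n ≤ (d + 2) * k + m) (≡-sym (+-∸-assoc d (s≤s z≤n))) bound

    χₗ : IsListChromaticNumber H k
    χₗ = hypothesis (d + 2) (m≤n+m 2 d) n H (stars-uniform G (d + 2)) k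
           (improperChromatic⇒chromatic d G H (stars-proper⇔improper G d) χᵈ) bound′
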